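{- Let $\mathcal F\subseteq\mathcal P([n])$ be $\mathcal N$-saturated, and let $A_1,\dots,A_k$ and $B_1,\dots,B_l$ be elements of $\mathcal F$, where $k,l\ge1$. If $\bigcap_{i=1}^kA_i\notin\mathcal F$, then in every induced copy of $\mathcal N$ in $\mathcal F\cup\{\bigcap_{i=1}^kA_i\}$ containing $\bigcap_{i=1}^kA_i$, the set $\bigcap_{i=1}^kA_i$ is a minimal element of the copy; moreover there exists an induced copy of $\mathcal N$ in $\mathcal F\cup\{\bigcap_{i=1}^kA_i\}$ in which $\bigcap_{i=1}^kA_i$ is the minimal element comparable to both maximal elements. Similarly, if $\bigcup_{i=1}^lB_i\notin\mathcal F$, then in every induced copy of $\mathcal N$ in $\mathcal F\cup\{\bigcup_{i=1}^lB_i\}$ containing $\bigcup_{i=1}^lB_i$, this set is a maximal element of the copy; moreover there exists an induced copy of $\mathcal N$ in $\mathcal F\cup\{\bigcup_{i=1}^lB_i\}$ in which $\bigcup_{i=1}^lB_i$ is the maximal element comparable to both minimal elements.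
   Context: $[n]=\{1,\dots,n\}$, $\mathcal P([n])$ its power set ordered by inclusion. The poset $\mathcal N$ has four elements $a,b,c,d$ with $a<c$, $b<c$, $b<d$ and no other comparabilities. A family contains an induced copy of $\mathcal N$ if it contains distinct sets $P,Q,R,S$ with $P\subset R$, $Q\subset R$, $Q\subset S$ and each of the pairs $\{P,Q\},\{P,S\},\{R,S\}$ incomparable; $P,Q$ are the minimal elements and $R,S$ the maximal elements of the copy, $R$ is the maximal element comparable to both minimal elements, and $Q$ is the minimal element comparable to both maximal elements. $\mathcal F$ is $\mathcal N$-saturated if it contains no induced copy of $\mathcal N$ but $\mathcal F\cup\{X\}$ contains one for every $X\in\mathcal P([n])\setminus\mathcal F$. -}

module Defs where

open import Level using (0ℓ)
open import Data.Nat using (ℕ)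
open import Data.Fin.Subset using (Subset; _⊂_; _⊆_)
open import Data.Product using (_×_)
open import Data.Sum using (_⊎_)
open import Relation.Nullary using (¬_)
open import Relation.Binary.PropositionalEquality using (_≡_; _≢_)

Family : ℕ → Set₁
Family n = Subset n → Set

_∪｛_｝ : ∀ {n} → Family n → Subset n → Family n
(F ∪｛ X ｝) Y = Y ≡ X ⊎ F Y

Incomparable : ∀ {n} → Subset n → Subset n → Set
Incomparable A B = ¬ (A ⊆ B) × ¬ (B ⊆ A)

-- P, Q minimal; R, S maximal; R comparable to both minimals; Q comparable to both maximals.
record InducedN {n} (G : Family n) : Set where
  field
    P Q R S : Subset n
    P∈ : G P
    Q∈ : G Q
    R∈ : G R
    S∈ : G S
    P≢Q : P ≢ Q
    P≢R : P ≢ R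
    P≢S : P ≢ S
    Q≢R : Q ≢ R
    Q≢S : Q ≢ S
    R≢S : R ≢ S
    P⊂R : P ⊂ R
    Q⊂R : Q ⊂ R
    Q⊂S : Q ⊂ S
    P∥Q : Incomparable P Q
    P∥S : Incomparable P S
    R∥S : Incomparable R S

_∈Copy_ : ∀ {n} {G : Family n} → Subset n → InducedN G → Set
X ∈Copy c = X ≡ P ⊎ X ≡ Q ⊎ X ≡ R ⊎ X ≡ S
  where open InducedN c

IsMinimalIn : ∀ {n} {G : Family n} → Subset n → InducedN G → Set
IsMinimalIn X c = X ≡ InducedN.P c ⊎ X ≡ InducedN.Q c

IsMaximalIn : ∀ {n} {G : Family n} → Subset n → InducedN G → Set
IsMaximalIn X c = X ≡ InducedN.R c ⊎ X ≡ InducedN.S c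

NSaturated : ∀ {n} → Family n → Set
NSaturated {n} F = ¬ InducedN F × (∀ (X : Subset n) → ¬ F X → InducedN (F ∪｛ X ｝))

{-# OPTIONS --safe #-}
-- Write X = ⋂ Aᵢ. Whenever Y ⊈ X, some Aᵢ already has Y ⊈ Aᵢ, while X ⊆ Aᵢ; so if X sat at a
-- maximal position of an induced N, a suitable Aᵢ could replace it and give an induced N inside F.
-- Hence X is minimal. Saturation provides a copy through X; if X is the minimal element P
-- comparable only to R, then with Q ⊈ Aᵢ the four sets Q, X, R, Aᵢ form a copy with X in the
-- role of Q (Aᵢ ⊆ R would make Aᵢ, Q, R, S an induced N in F). Complementation reverses
-- inclusion, maps ⋃ Bⱼ to the intersection of the complements and N to itself, which gives the
-- union half.
module Submission where

open import Defs
open import Algebra.Lattice.Properties.BooleanAlgebra as BooleanAlgebraProperties using ()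
open import Data.Nat using (ℕ; suc)
open import Data.Fin using (Fin; zero; suc)
open import Data.Fin.Properties using (any?; ¬∀⟶∃¬)
open import Data.Fin.Subset using (Subset; ⋂; ⋃; ∁; _⊆_; _⊈_; _⊂_; _∈_; _∉_)
open import Data.Fin.Subset.Properties
  using (⊆-trans; ⊆-antisym; _⊆?_; _∈?_; ⊆⊤; ⊥⊆; p∩q⊆p; p∩q⊆q; x∈p∩q⁺; p⊆p∪q; q⊆p∪q; x∈p∪q⁻;
         x∈p⇒x∉∁p; x∉p⇒x∈∁p; p⊆q⇒∁p⊇∁q; ∁p⊆∁q⇒p⊇q; ∪-∩-booleanAlgebra)
open import Data.Vec using (Vec; []; _∷_; lookup; toList)
open import Data.Product using (_×_; _,_; proj₁; Σ; ∃)
open import Data.Sum using (_⊎_; inj₁; inj₂; [_,_])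
open import Function using (id; _∘_)
open import Relation.Nullary using (¬_; yes; no; contradiction)
open import Relation.Nullary.Decidable using (_×-dec_; ¬?; decidable-stable)
open import Relation.Binary.PropositionalEquality
  using (_≡_; _≢_; refl; sym; trans; cong; subst; ≢-sym; module ≡-Reasoning)

private
  variable
    n m : ℕ
    A B P Q R S X Y : Subset n
    F G H : Family n

-- Strict inclusion without a witness; equivalent to `_⊂_` because `_∈_` is decidable.
_⊊_ : Subset n → Subset n → Set
A ⊊ B = A ⊆ B × B ⊈ A

⊈⇒∃∈∉ : A ⊈ B → ∃ λ x → x ∈ A × x ∉ B
⊈⇒∃∈∉ {A = A} {B} A⊈B with any? (λ x → x ∈? A ×-dec ¬? (x ∈? B))
... | yes witness = witness
... | no none =
  contradiction (λ {x} x∈A → decidable-stable (x ∈? B) (λ x∉B → none (x , x∈A , x∉B))) A⊈B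

⊊⇒⊂ : A ⊊ B → A ⊂ B
⊊⇒⊂ (A⊆B , B⊈A) = A⊆B , ⊈⇒∃∈∉ B⊈A

⊂⇒⊊ : A ⊂ B → A ⊊ B
⊂⇒⊊ (A⊆B , x , x∈B , x∉A) = A⊆B , λ B⊆A → x∉A (B⊆A x∈B)

⊊⇒≢ : A ⊊ B → A ≢ B
⊊⇒≢ (_ , B⊈A) refl = B⊈A id

∥⇒≢ : Incomparable A B → A ≢ B
∥⇒≢ (A⊈B , _) refl = A⊈B id

record IsN (P Q R S : Subset n) : Set where
  constructor isN
  field
    P⊊R : P ⊊ R
    Q⊊R : Q ⊊ R
    Q⊊S : Q ⊊ S
    P∥Q : Incomparable P Q
    P∥S : Incomparable P S
    R∥S : Incomparable R S

inducedN : G P → G Q → G R → G S → IsN P Q R S → InducedN G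
inducedN {P = P} {Q = Q} {R = R} {S = S} P∈ Q∈ R∈ S∈ (isN P⊊R Q⊊R Q⊊S P∥Q P∥S R∥S) = record
  { P = P ; Q = Q ; R = R ; S = S
  ; P∈ = P∈ ; Q∈ = Q∈ ; R∈ = R∈ ; S∈ = S∈
  ; P≢Q = ∥⇒≢ P∥Q ; P≢R = ⊊⇒≢ P⊊R ; P≢S = ∥⇒≢ P∥S
  ; Q≢R = ⊊⇒≢ Q⊊R ; Q≢S = ⊊⇒≢ Q⊊S ; R≢S = ∥⇒≢ R∥S
  ; P⊂R = ⊊⇒⊂ P⊊R ; Q⊂R = ⊊⇒⊂ Q⊊R ; Q⊂S = ⊊⇒⊂ Q⊊S
  ; P∥Q = P∥Q ; P∥S = P∥S ; R∥S = R∥S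
  }

isN-of : (c : InducedN G) → IsN (InducedN.P c) (InducedN.Q c) (InducedN.R c) (InducedN.S c)
isN-of c = isN (⊂⇒⊊ P⊂R) (⊂⇒⊊ Q⊂R) (⊂⇒⊊ Q⊂S) P∥Q P∥S R∥S
  where open InducedN c

mapInducedN : (∀ {Y} → G Y → H Y) → InducedN G → InducedN H
mapInducedN G⊆H c = inducedN (G⊆H P∈) (G⊆H Q∈) (G⊆H R∈) (G⊆H S∈) (isN-of c)
  where open InducedN c

∈Copy⊎InducedN : (c : InducedN (F ∪｛ X ｝)) → X ∈Copy c ⊎ InducedN F
∈Copy⊎InducedN c with InducedN.P∈ c | InducedN.Q∈ c | InducedN.R∈ c | InducedN.S∈ c
... | inj₁ P≡X | _        | _        | _        = inj₁ (inj₁ (sym P≡X))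
... | inj₂ _   | inj₁ Q≡X | _        | _        = inj₁ (inj₂ (inj₁ (sym Q≡X)))
... | inj₂ _   | inj₂ _   | inj₁ R≡X | _        = inj₁ (inj₂ (inj₂ (inj₁ (sym R≡X))))
... | inj₂ _   | inj₂ _   | inj₂ _   | inj₁ S≡X = inj₁ (inj₂ (inj₂ (inj₂ (sym S≡X))))
... | inj₂ P∈F | inj₂ Q∈F | inj₂ R∈F | inj₂ S∈F = inj₂ (inducedN P∈F Q∈F R∈F S∈F (isN-of c))

module Meet {F : Family n} (N-free : ¬ InducedN F)
            {m} (a : Fin m → Subset n) (a∈F : ∀ i → F (a i))
            {X : Subset n} (X∉F : ¬ F X)
            (X⊆a : ∀ i → X ⊆ a i) (greatest : ∀ {Y} → (∀ i → Y ⊆ a i) → Y ⊆ X) where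

  ∈F : (F ∪｛ X ｝) Y → Y ≢ X → F Y
  ∈F (inj₁ Y≡X) Y≢X = contradiction Y≡X Y≢X
  ∈F (inj₂ Y∈F) _   = Y∈F

  separate : Y ⊈ X → ∃ λ i → Y ⊈ a i
  separate {Y = Y} Y⊈X = ¬∀⟶∃¬ m (λ i → Y ⊆ a i) (λ i → Y ⊆? a i) (Y⊈X ∘ greatest)

  ⊊X⇒⊊a : ∀ i → Y ⊊ X → Y ⊊ a i
  ⊊X⇒⊊a i (Y⊆X , X⊈Y) = ⊆-trans Y⊆X (X⊆a i) , X⊈Y ∘ ⊆-trans (X⊆a i)

  X⊈⇒a⊈ : ∀ i → X ⊈ Y → a i ⊈ Y
  X⊈⇒a⊈ i X⊈Y = X⊈Y ∘ ⊆-trans (X⊆a i)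

  X-not-at-R : (F ∪｛ X ｝) P → (F ∪｛ X ｝) Q → (F ∪｛ X ｝) S → IsN P Q R S → X ≢ R
  X-not-at-R P∈ Q∈ S∈ (isN P⊊X Q⊊X Q⊊S P∥Q P∥S (X⊈S , S⊈X)) refl with separate S⊈X
  ... | i , S⊈a = N-free (inducedN
    (∈F P∈ (⊊⇒≢ P⊊X)) (∈F Q∈ (⊊⇒≢ Q⊊X)) (a∈F i) (∈F S∈ (≢-sym (∥⇒≢ (X⊈S , S⊈X))))
    (isN (⊊X⇒⊊a i P⊊X) (⊊X⇒⊊a i Q⊊X) Q⊊S P∥Q P∥S (X⊈⇒a⊈ i X⊈S , S⊈a)))

  X-not-at-S : (F ∪｛ X ｝) P → (F ∪｛ X ｝) Q → (F ∪｛ X ｝) R → IsN P Q R S → X ≢ S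
  X-not-at-S P∈ Q∈ R∈ (isN P⊊R Q⊊R Q⊊X P∥Q (P⊈X , X⊈P) (R⊈X , X⊈R)) refl with separate P⊈X
  ... | i , P⊈a = N-free (inducedN
    (∈F P∈ (∥⇒≢ (P⊈X , X⊈P))) (∈F Q∈ (⊊⇒≢ Q⊊X)) (∈F R∈ (∥⇒≢ (R⊈X , X⊈R))) (a∈F i)
    (isN P⊊R Q⊊R (⊊X⇒⊊a i Q⊊X) P∥Q
         (P⊈a , X⊈⇒a⊈ i X⊈P) (P⊈a ∘ ⊆-trans (proj₁ P⊊R) , X⊈⇒a⊈ i X⊈R)))

  X∈Copy⇒minimal : (c : InducedN (F ∪｛ X ｝)) → X ∈Copy c → IsMinimalIn X c
  X∈Copy⇒minimal c (inj₁ X≡P)               = inj₁ X≡P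
  X∈Copy⇒minimal c (inj₂ (inj₁ X≡Q))        = inj₂ X≡Q
  X∈Copy⇒minimal c (inj₂ (inj₂ (inj₁ X≡R))) = contradiction X≡R (X-not-at-R P∈ Q∈ S∈ (isN-of c))
    where open InducedN c
  X∈Copy⇒minimal c (inj₂ (inj₂ (inj₂ X≡S))) = contradiction X≡S (X-not-at-S P∈ Q∈ R∈ (isN-of c))
    where open InducedN c

  move-X-from-P-to-Q : (F ∪｛ X ｝) Q → (F ∪｛ X ｝) R → (F ∪｛ X ｝) S → IsN P Q R S → X ≡ P →
                       Σ (InducedN (F ∪｛ X ｝)) (λ c → X ≡ InducedN.Q c)
  move-X-from-P-to-Q {Q = Q} {R = R} Q∈ R∈ S∈
                     (isN X⊊R Q⊊R Q⊊S (X⊈Q , Q⊈X) (X⊈S , S⊈X) (R⊈S , S⊈R)) refl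
    with separate Q⊈X
  ... | i , Q⊈a = inducedN Q∈ (inj₁ refl) R∈ (inj₂ (a∈F i))
                    (isN Q⊊R X⊊R X⊊a (Q⊈X , X⊈Q) (Q⊈a , a⊈Q) (R⊈a , a⊈R))
                , refl
    where
    X⊊a : X ⊊ a i
    X⊊a = X⊆a i , λ a⊆X → X∉F (subst F (⊆-antisym a⊆X (X⊆a i)) (a∈F i))
    a⊈Q : a i ⊈ Q
    a⊈Q = X⊈⇒a⊈ i X⊈Q
    R⊈a : R ⊈ a i
    R⊈a = Q⊈a ∘ ⊆-trans (proj₁ Q⊊R)
    a⊈R : a i ⊈ R
    a⊈R a⊆R = N-free (inducedN
      (a∈F i) (∈F Q∈ (≢-sym (∥⇒≢ (X⊈Q , Q⊈X)))) (∈F R∈ (≢-sym (⊊⇒≢ X⊊R)))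
      (∈F S∈ (≢-sym (∥⇒≢ (X⊈S , S⊈X))))
      (isN (a⊆R , R⊈a) Q⊊R Q⊊S (a⊈Q , Q⊈a)
           (X⊈⇒a⊈ i X⊈S , λ S⊆a → S⊈R (⊆-trans S⊆a a⊆R)) (R⊈S , S⊈R)))

  copy-with-X-as-Q : InducedN (F ∪｛ X ｝) → Σ (InducedN (F ∪｛ X ｝)) (λ c → X ≡ InducedN.Q c)
  copy-with-X-as-Q c with ∈Copy⊎InducedN c
  ... | inj₂ c∈F = contradiction c∈F N-free
  ... | inj₁ X∈c with X∈Copy⇒minimal c X∈c
  ...   | inj₂ X≡Q = c , X≡Q
  ...   | inj₁ X≡P = move-X-from-P-to-Q Q∈ R∈ S∈ (isN-of c) X≡P
    where open InducedN c

∁-involutive : (A : Subset n) → ∁ (∁ A) ≡ A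
∁-involutive {n} = BooleanAlgebraProperties.¬-involutive (∪-∩-booleanAlgebra n)

∁-injective : ∁ A ≡ ∁ B → A ≡ B
∁-injective {A = A} {B = B} ∁A≡∁B = begin
  A         ≡⟨ sym (∁-involutive A) ⟩
  ∁ (∁ A)   ≡⟨ cong ∁ ∁A≡∁B ⟩
  ∁ (∁ B)   ≡⟨ ∁-involutive B ⟩
  B         ∎
  where open ≡-Reasoning

⊆∁⇒⊆∁ : A ⊆ ∁ B → B ⊆ ∁ A
⊆∁⇒⊆∁ A⊆∁B x∈B = x∉p⇒x∈∁p (x∈p⇒x∉∁p x∈B ∘ A⊆∁B)

∁-⊊ : A ⊊ B → ∁ B ⊊ ∁ A
∁-⊊ (A⊆B , B⊈A) = p⊆q⇒∁p⊇∁q A⊆B , B⊈A ∘ ∁p⊆∁q⇒p⊇q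

∁-∥ : Incomparable A B → Incomparable (∁ B) (∁ A)
∁-∥ (A⊈B , B⊈A) = A⊈B ∘ ∁p⊆∁q⇒p⊇q , B⊈A ∘ ∁p⊆∁q⇒p⊇q

∈∁∁ : (G : Family n) → G Y → G (∁ (∁ Y))
∈∁∁ {Y = Y} G = subst G (sym (∁-involutive Y))

∁-IsN : IsN P Q R S → IsN (∁ S) (∁ R) (∁ Q) (∁ P)
∁-IsN (isN P⊊R Q⊊R Q⊊S P∥Q P∥S R∥S) =
  isN (∁-⊊ Q⊊S) (∁-⊊ Q⊊R) (∁-⊊ P⊊R) (∁-∥ R∥S) (∁-∥ P∥S) (∁-∥ P∥Q)

∁-InducedN : InducedN G → InducedN (G ∘ ∁)
∁-InducedN {G = G} c =
  inducedN (∈∁∁ G S∈) (∈∁∁ G R∈) (∈∁∁ G Q∈) (∈∁∁ G P∈) (∁-IsN (isN-of c))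
  where open InducedN c

module Join {F : Family n} (N-free : ¬ InducedN F)
            {m} (b : Fin m → Subset n) (b∈F : ∀ j → F (b j))
            {X : Subset n} (X∉F : ¬ F X)
            (b⊆X : ∀ j → b j ⊆ X) (least : ∀ {Y} → (∀ j → b j ⊆ Y) → X ⊆ Y) where

  ∁-N-free : ¬ InducedN (F ∘ ∁)
  ∁-N-free = N-free ∘ mapInducedN (λ {Y} → subst F (∁-involutive Y)) ∘ ∁-InducedN

  ∁-greatest : (∀ j → Y ⊆ ∁ (b j)) → Y ⊆ ∁ X
  ∁-greatest Y⊆∁b = ⊆∁⇒⊆∁ (least (⊆∁⇒⊆∁ ∘ Y⊆∁b))

  open Meet ∁-N-free (∁ ∘ b) (∈∁∁ F ∘ b∈F) (X∉F ∘ subst F (∁-involutive X))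
            (p⊆q⇒∁p⊇∁q ∘ b⊆X) ∁-greatest

  to-∁ : (F ∪｛ X ｝) (∁ Y) → ((F ∘ ∁) ∪｛ ∁ X ｝) Y
  to-∁ {Y = Y} (inj₁ ∁Y≡X) = inj₁ (trans (sym (∁-involutive Y)) (cong ∁ ∁Y≡X))
  to-∁ (inj₂ ∁Y∈F)         = inj₂ ∁Y∈F

  from-∁ : ((F ∘ ∁) ∪｛ ∁ X ｝) (∁ Y) → (F ∪｛ X ｝) Y
  from-∁ (inj₁ ∁Y≡∁X)         = inj₁ (∁-injective ∁Y≡∁X)
  from-∁ {Y = Y} (inj₂ ∁∁Y∈F) = inj₂ (subst F (∁-involutive Y) ∁∁Y∈F)

  ∁-copy : InducedN (F ∪｛ X ｝) → InducedN ((F ∘ ∁) ∪｛ ∁ X ｝)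
  ∁-copy = mapInducedN to-∁ ∘ ∁-InducedN

  ∁-∈Copy : (c : InducedN (F ∪｛ X ｝)) → X ∈Copy c → ∁ X ∈Copy ∁-copy c
  ∁-∈Copy c (inj₁ X≡P)               = inj₂ (inj₂ (inj₂ (cong ∁ X≡P)))
  ∁-∈Copy c (inj₂ (inj₁ X≡Q))        = inj₂ (inj₂ (inj₁ (cong ∁ X≡Q)))
  ∁-∈Copy c (inj₂ (inj₂ (inj₁ X≡R))) = inj₂ (inj₁ (cong ∁ X≡R))
  ∁-∈Copy c (inj₂ (inj₂ (inj₂ X≡S))) = inj₁ (cong ∁ X≡S)

  X∈Copy⇒maximal : (c : InducedN (F ∪｛ X ｝)) → X ∈Copy c → IsMaximalIn X c
  X∈Copy⇒maximal c X∈c with X∈Copy⇒minimal (∁-copy c) (∁-∈Copy c X∈c)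
  ... | inj₁ ∁X≡∁S = inj₂ (∁-injective ∁X≡∁S)
  ... | inj₂ ∁X≡∁R = inj₁ (∁-injective ∁X≡∁R)

  copy-with-X-as-R : InducedN (F ∪｛ X ｝) → Σ (InducedN (F ∪｛ X ｝)) (λ c → X ≡ InducedN.R c)
  copy-with-X-as-R c with copy-with-X-as-Q (∁-copy c)
  ... | c′ , ∁X≡Q =
    mapInducedN from-∁ (∁-InducedN c′) , trans (sym (∁-involutive X)) (cong ∁ ∁X≡Q)

⋂-lower : (A : Vec (Subset n) m) → ∀ i → ⋂ (toList A) ⊆ lookup A i
⋂-lower (A₀ ∷ As) zero    = p∩q⊆p A₀ _
⋂-lower (A₀ ∷ As) (suc i) = ⊆-trans (p∩q⊆q A₀ _) (⋂-lower As i)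

⋂-greatest : (A : Vec (Subset n) m) → (∀ i → Y ⊆ lookup A i) → Y ⊆ ⋂ (toList A)
⋂-greatest []        _     = ⊆⊤
⋂-greatest (A₀ ∷ As) Y⊆A x∈Y = x∈p∩q⁺ (Y⊆A zero x∈Y , ⋂-greatest As (Y⊆A ∘ suc) x∈Y)

⋃-upper : (B : Vec (Subset n) m) → ∀ j → lookup B j ⊆ ⋃ (toList B)
⋃-upper (B₀ ∷ Bs) zero    = p⊆p∪q _
⋃-upper (B₀ ∷ Bs) (suc j) = ⊆-trans (⋃-upper Bs j) (q⊆p∪q B₀ _)

⋃-least : (B : Vec (Subset n) m) → (∀ j → lookup B j ⊆ Y) → ⋃ (toList B) ⊆ Y
⋃-least []        _     = ⊥⊆
⋃-least (B₀ ∷ Bs) B⊆Y x∈⋃ = [ B⊆Y zero , ⋃-least Bs (B⊆Y ∘ suc) ] (x∈p∪q⁻ B₀ _ x∈⋃)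

lemma2p2 : ∀ {n} (F : Family n) → NSaturated F →
    ∀ (k l : ℕ) (A : Vec (Subset n) (suc k)) (B : Vec (Subset n) (suc l)) →
    (∀ i → F (lookup A i)) → (∀ j → F (lookup B j)) →
    ((¬ F (⋂ (toList A)) →
        ((c : InducedN (F ∪｛ ⋂ (toList A) ｝)) → ⋂ (toList A) ∈Copy c → IsMinimalIn (⋂ (toList A)) c)
        × Σ (InducedN (F ∪｛ ⋂ (toList A) ｝)) (λ c → ⋂ (toList A) ≡ InducedN.Q c))
    × (¬ F (⋃ (toList B)) →
        ((c : InducedN (F ∪｛ ⋃ (toList B) ｝)) → ⋃ (toList B) ∈Copy c → IsMaximalIn (⋃ (toList B)) c)
        × Σ (InducedN (F ∪｛ ⋃ (toList B) ｝)) (λ c → ⋃ (toList B) ≡ InducedN.R c)))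
lemma2p2 F (N-free , saturated) k l A B A∈F B∈F =
  (λ ⋂∉F → let open Meet N-free (lookup A) A∈F ⋂∉F (⋂-lower A) (⋂-greatest A)
           in X∈Copy⇒minimal , copy-with-X-as-Q (saturated _ ⋂∉F))
  , (λ ⋃∉F → let open Join N-free (lookup B) B∈F ⋃∉F (⋃-upper B) (⋃-least B)
             in X∈Copy⇒maximal , copy-with-X-as-R (saturated _ ⋃∉F))
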